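{- A discrete fibration $P:\mathbb{C}\to\mathbb{D}$ has a left adjoint if and only if it is an isomorphism of categories.
   Context: A functor $P:\mathbb{C}\to\mathbb{D}$ is a discrete fibration if for every object $C$ of $\mathbb{C}$ and every morphism $u:D'\to P(C)$ in $\mathbb{D}$ there is a unique morphism $\tilde u$ in $\mathbb{C}$ with codomain $C$ and $P(\tilde u)=u$. -}

module Defs where

open import Level using (Level; _⊔_) renaming (suc to lsuc)
open import Data.Product using (Σ; Σ-syntax; _,_)
open import Relation.Binary.PropositionalEquality using (_≡_; subst; subst₂)

record Category (o ℓ : Level) : Set (lsuc (o ⊔ ℓ)) where
  infixr 9 _∘_
  field
    Obj       : Set o
    Hom       : Obj → Obj → Set ℓ
    id        : ∀ {A} → Hom A A
    _∘_       : ∀ {A B C} → Hom B C → Hom A B → Hom A C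
    identityˡ : ∀ {A B} (f : Hom A B) → id ∘ f ≡ f
    identityʳ : ∀ {A B} (f : Hom A B) → f ∘ id ≡ f
    assoc     : ∀ {A B C D} (f : Hom A B) (g : Hom B C) (h : Hom C D) →
                (h ∘ g) ∘ f ≡ h ∘ (g ∘ f)

open Category

record Functor {o ℓ o′ ℓ′} (C : Category o ℓ) (D : Category o′ ℓ′)
       : Set (o ⊔ ℓ ⊔ o′ ⊔ ℓ′) where
  field
    F₀           : Obj C → Obj D
    F₁           : ∀ {A B} → Hom C A B → Hom D (F₀ A) (F₀ B)
    identity     : ∀ {A} → F₁ (id C {A}) ≡ id D
    homomorphism : ∀ {A B E} (f : Hom C A B) (g : Hom C B E) →
                   F₁ (_∘_ C g f) ≡ _∘_ D (F₁ g) (F₁ f)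

open Functor

Idᶠ : ∀ {o ℓ} (C : Category o ℓ) → Functor C C
Idᶠ C = record
  { F₀ = λ X → X ; F₁ = λ f → f
  ; identity = Relation.Binary.PropositionalEquality.refl
  ; homomorphism = λ f g → Relation.Binary.PropositionalEquality.refl }

_∘F_ : ∀ {o₁ ℓ₁ o₂ ℓ₂ o₃ ℓ₃} {C : Category o₁ ℓ₁} {D : Category o₂ ℓ₂}
       {E : Category o₃ ℓ₃} → Functor D E → Functor C D → Functor C E
_∘F_ {C = C} {D} {E} G F = record
  { F₀ = λ X → F₀ G (F₀ F X)
  ; F₁ = λ f → F₁ G (F₁ F f)
  ; identity = Relation.Binary.PropositionalEquality.trans
                 (Relation.Binary.PropositionalEquality.cong (F₁ G) (identity F))
                 (identity G)
  ; homomorphism = λ f g → Relation.Binary.PropositionalEquality.trans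
                 (Relation.Binary.PropositionalEquality.cong (F₁ G) (homomorphism F f g))
                 (homomorphism G (F₁ F f) (F₁ F g))
  }

record NatTrans {o ℓ o′ ℓ′} {C : Category o ℓ} {D : Category o′ ℓ′}
       (F G : Functor C D) : Set (o ⊔ ℓ ⊔ ℓ′) where
  field
    η       : ∀ X → Hom D (F₀ F X) (F₀ G X)
    natural : ∀ {X Y} (f : Hom C X Y) →
              _∘_ D (η Y) (F₁ F f) ≡ _∘_ D (F₁ G f) (η X)

open NatTrans

record Adjunction {o ℓ o′ ℓ′} {C : Category o ℓ} {D : Category o′ ℓ′}
       (L : Functor D C) (R : Functor C D) : Set (o ⊔ ℓ ⊔ o′ ⊔ ℓ′) where
  field
    unit   : NatTrans (Idᶠ D) (R ∘F L)
    counit : NatTrans (L ∘F R) (Idᶠ C)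
    zig    : ∀ (X : Obj D) →
             _∘_ C (η counit (F₀ L X)) (F₁ L (η unit X)) ≡ id C
    zag    : ∀ (Y : Obj C) →
             _∘_ D (F₁ R (η counit Y)) (η unit (F₀ R Y)) ≡ id D

HasLeftAdjoint : ∀ {o ℓ o′ ℓ′} {C : Category o ℓ} {D : Category o′ ℓ′} →
                 Functor C D → Set (o ⊔ ℓ ⊔ o′ ⊔ ℓ′)
HasLeftAdjoint {C = C} {D} P = Σ[ L ∈ Functor D C ] Adjunction L P

-- P is a discrete fibration: for every object C and u : D′ → P C there is a
-- unique morphism ũ (i.e. a unique pair (C′ , ũ : C′ → C)) with codomain C and
-- P ũ = u (where P ũ = u includes P C′ = D′).
IsLift : ∀ {o ℓ o′ ℓ′} {C : Category o ℓ} {D : Category o′ ℓ′} →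
         (P : Functor C D) (X : Obj C) {D′ : Obj D} (u : Hom D D′ (F₀ P X)) →
         Σ[ X′ ∈ Obj C ] Hom C X′ X → Set (o′ ⊔ ℓ′)
IsLift {C = C} {D} P X {D′} u (X′ , f) =
  Σ[ e ∈ F₀ P X′ ≡ D′ ] subst (λ Y → Hom D Y (F₀ P X)) e (F₁ P f) ≡ u

IsDiscreteFibration : ∀ {o ℓ o′ ℓ′} {C : Category o ℓ} {D : Category o′ ℓ′} →
                      Functor C D → Set (o ⊔ ℓ ⊔ o′ ⊔ ℓ′)
IsDiscreteFibration {C = C} {D} P =
  ∀ (X : Obj C) {D′ : Obj D} (u : Hom D D′ (F₀ P X)) →
  Σ[ ũ ∈ Σ[ X′ ∈ Obj C ] Hom C X′ X ]
    (IsLift P X u ũ × (∀ ṽ → IsLift P X u ṽ → ṽ ≡ ũ))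
  where open import Data.Product using (_×_)

-- P is an isomorphism of categories: there is a functor G with
-- G ∘F P = Id and P ∘F G = Id (functor equality written out: equal on
-- objects, and equal on morphisms up to transport along the object equalities).
record IsIsomorphism {o ℓ o′ ℓ′} {C : Category o ℓ} {D : Category o′ ℓ′}
       (P : Functor C D) : Set (o ⊔ ℓ ⊔ o′ ⊔ ℓ′) where
  field
    inv    : Functor D C
    isoˡ₀  : ∀ X → F₀ inv (F₀ P X) ≡ X
    isoˡ₁  : ∀ {X Y} (f : Hom C X Y) →
             subst₂ (Hom C) (isoˡ₀ X) (isoˡ₀ Y) (F₁ inv (F₁ P f)) ≡ f
    isoʳ₀  : ∀ Y → F₀ P (F₀ inv Y) ≡ Y
    isoʳ₁  : ∀ {X Y} (g : Hom D X Y) →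
             subst₂ (Hom D) (isoʳ₀ X) (isoʳ₀ Y) (F₁ P (F₁ inv g)) ≡ g

{-# OPTIONS --with-K #-}
-- An isomorphism is left adjoint to its inverse, with unit and counit the
-- identities transported along the object equations. Conversely, let L ⊣ P
-- with P a discrete fibration. Lifting the unit η_X : X → P(L X) gives an
-- object G X over X; for an object Y, composing the lift of η_{P Y} with the
-- counit ε_Y lifts P ε_Y ∘ η_{P Y} = id (triangle identity), as does id_Y, so
-- uniqueness of lifts forces G (P Y) = Y. Hence P is bijective on objects;
-- uniqueness of lifts also makes P faithful, and it is full because a lift of
-- g : P A → P B lies over P A, so its domain is A.
module Submission where

open import Defs
open import Function.Bundles using (_⇔_; mk⇔)
open import Data.Product using (Σ-syntax; _,_; proj₁; proj₂)
open import Data.Product.Properties.WithK using (,-injectiveʳ)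
open import Relation.Binary.PropositionalEquality
open Category
open Functor
open NatTrans

module Transport {o ℓ} (C : Category o ℓ) where

  ≡⇒hom : ∀ {A B} → A ≡ B → Hom C A B
  ≡⇒hom refl = id C

  ≡⇒hom-cancel : ∀ {A B} (p : A ≡ B) (q : B ≡ A) → _∘_ C (≡⇒hom p) (≡⇒hom q) ≡ id C
  ≡⇒hom-cancel refl refl = identityˡ C (id C)

  ≡⇒hom-square : ∀ {X Y X′ Y′} (a : X′ ≡ X) (b : Y′ ≡ Y) (h : Hom C X′ Y′) →
                 _∘_ C (≡⇒hom b) h ≡ _∘_ C (subst₂ (Hom C) a b h) (≡⇒hom a)
  ≡⇒hom-square refl refl h = trans (identityˡ C h) (sym (identityʳ C h))

  ≡⇒hom-square⁻¹ : ∀ {X Y X′ Y′} (a : X′ ≡ X) (b : Y′ ≡ Y) (h : Hom C X′ Y′) →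
                   _∘_ C (≡⇒hom (sym b)) (subst₂ (Hom C) a b h) ≡ _∘_ C h (≡⇒hom (sym a))
  ≡⇒hom-square⁻¹ refl refl h = trans (identityˡ C h) (sym (identityʳ C h))

  subst₂-id : ∀ {A B} (p : A ≡ B) → subst₂ (Hom C) p p (id C) ≡ id C
  subst₂-id refl = refl

  subst₂-∘ : ∀ {A B E A′ B′ E′} (p : A ≡ A′) (q : B ≡ B′) (r : E ≡ E′)
             (f : Hom C A B) (g : Hom C B E) →
             subst₂ (Hom C) p r (_∘_ C g f) ≡
             _∘_ C (subst₂ (Hom C) q r g) (subst₂ (Hom C) p q f)
  subst₂-∘ refl refl refl f g = refl

  subst₂-subst₂-sym : ∀ {A B A′ B′} (p : A′ ≡ A) (q : B′ ≡ B) (g : Hom C A B) →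
                      subst₂ (Hom C) p q (subst₂ (Hom C) (sym p) (sym q) g) ≡ g
  subst₂-subst₂-sym refl refl g = refl

module _ {o ℓ o′ ℓ′} {C : Category o ℓ} {D : Category o′ ℓ′} (F : Functor C D) where
  open Transport

  F₁-≡⇒hom : ∀ {A B} (p : A ≡ B) → F₁ F (≡⇒hom C p) ≡ ≡⇒hom D (cong (F₀ F) p)
  F₁-≡⇒hom refl = identity F

  faithful-subst₂ : (∀ {A B} (f g : Hom C A B) → F₁ F f ≡ F₁ F g → f ≡ g) →
                    ∀ {A B A′ B′} (a : A′ ≡ A) (b : B′ ≡ B)
                    (p : F₀ F A′ ≡ F₀ F A) (q : F₀ F B′ ≡ F₀ F B)
                    (h : Hom C A′ B′) (f : Hom C A B) →
                    F₁ F h ≡ subst₂ (Hom D) (sym p) (sym q) (F₁ F f) →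
                    subst₂ (Hom C) a b h ≡ f
  faithful-subst₂ faithful refl refl refl refl h f = faithful h f

module _ {o ℓ o′ ℓ′} {C : Category o ℓ} {D : Category o′ ℓ′} {P : Functor C D}
         (I : IsIsomorphism P) where
  open IsIsomorphism I
  open Transport

  IsIsomorphism⇒inv⊣ : Adjunction inv P
  IsIsomorphism⇒inv⊣ = record
    { unit   = record { η = λ X → ≡⇒hom D (sym (isoʳ₀ X))
                      ; natural = λ {X} {Y} g →
                          trans (cong (_∘_ D _) (sym (isoʳ₁ g)))
                                (≡⇒hom-square⁻¹ D (isoʳ₀ X) (isoʳ₀ Y) _) }
    ; counit = record { η = λ X → ≡⇒hom C (isoˡ₀ X)
                      ; natural = λ {X} {Y} f →
                          trans (≡⇒hom-square C (isoˡ₀ X) (isoˡ₀ Y) _)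
                                (cong (λ h → _∘_ C h _) (isoˡ₁ f)) }
    ; zig    = λ X → trans (cong (_∘_ C _) (F₁-≡⇒hom inv (sym (isoʳ₀ X))))
                           (≡⇒hom-cancel C (isoˡ₀ (F₀ inv X)) (cong (F₀ inv) (sym (isoʳ₀ X))))
    ; zag    = λ Y → trans (cong (λ h → _∘_ D h _) (F₁-≡⇒hom P (isoˡ₀ Y)))
                           (≡⇒hom-cancel D (cong (F₀ P) (isoˡ₀ Y)) (sym (isoʳ₀ (F₀ P Y))))
    }

module _ {o ℓ o′ ℓ′} {C : Category o ℓ} {D : Category o′ ℓ′} (P : Functor C D)
         (G₀ : Obj D → Obj C)
         (P₀∘G₀ : ∀ X → F₀ P (G₀ X) ≡ X) (G₀∘P₀ : ∀ Y → G₀ (F₀ P Y) ≡ Y)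
         (full : ∀ {A B} (g : Hom D (F₀ P A) (F₀ P B)) → Σ[ f ∈ Hom C A B ] F₁ P f ≡ g)
         (faithful : ∀ {A B} (f g : Hom C A B) → F₁ P f ≡ F₁ P g → f ≡ g) where
  open Transport

  private
    preimage : ∀ {A B} → Hom D (F₀ P A) (F₀ P B) → Hom C A B
    preimage g = proj₁ (full g)

    P₁-preimage : ∀ {A B} (g : Hom D (F₀ P A) (F₀ P B)) → F₁ P (preimage g) ≡ g
    P₁-preimage g = proj₂ (full g)

    G₁ : ∀ {X Y} → Hom D X Y → Hom C (G₀ X) (G₀ Y)
    G₁ {X} {Y} g = preimage (subst₂ (Hom D) (sym (P₀∘G₀ X)) (sym (P₀∘G₀ Y)) g)

    G : Functor D C
    G = record
      { F₀ = G₀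
      ; F₁ = G₁
      ; identity = λ {X} → faithful _ _ (begin
          F₁ P (G₁ (id D))  ≡⟨ P₁-preimage _ ⟩
          subst₂ (Hom D) _ _ (id D)  ≡⟨ subst₂-id D (sym (P₀∘G₀ X)) ⟩
          id D  ≡⟨ sym (identity P) ⟩
          F₁ P (id C)  ∎)
      ; homomorphism = λ {X} {Y} {Z} f g → faithful _ _ (begin
          F₁ P (G₁ (_∘_ D g f))  ≡⟨ P₁-preimage _ ⟩
          subst₂ (Hom D) _ _ (_∘_ D g f)
            ≡⟨ subst₂-∘ D (sym (P₀∘G₀ X)) (sym (P₀∘G₀ Y)) (sym (P₀∘G₀ Z)) f g ⟩
          _∘_ D (subst₂ (Hom D) _ _ g) (subst₂ (Hom D) _ _ f)
            ≡⟨ sym (cong₂ (_∘_ D) (P₁-preimage _) (P₁-preimage _)) ⟩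
          _∘_ D (F₁ P (G₁ g)) (F₁ P (G₁ f))  ≡⟨ sym (homomorphism P _ _) ⟩
          F₁ P (_∘_ C (G₁ g) (G₁ f))  ∎)
      }
      where open ≡-Reasoning

  bijective₀-fullyFaithful⇒IsIsomorphism : IsIsomorphism P
  bijective₀-fullyFaithful⇒IsIsomorphism = record
    { inv   = G
    ; isoˡ₀ = G₀∘P₀
    ; isoˡ₁ = λ {X} {Y} f →
        faithful-subst₂ P faithful (G₀∘P₀ X) (G₀∘P₀ Y) _ _ _ f (P₁-preimage _)
    ; isoʳ₀ = P₀∘G₀
    ; isoʳ₁ = λ {X} {Y} g →
        trans (cong (subst₂ (Hom D) (P₀∘G₀ X) (P₀∘G₀ Y)) (P₁-preimage _))
              (subst₂-subst₂-sym D (P₀∘G₀ X) (P₀∘G₀ Y) g)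
    }

module DiscreteFibration {o ℓ o′ ℓ′} {C : Category o ℓ} {D : Category o′ ℓ′}
                         {P : Functor C D} (fib : IsDiscreteFibration P) where

  IsLift-∘ : ∀ {X Y X′ D′} {u : Hom D D′ (F₀ P X)} {f : Hom C X′ X} →
             IsLift P X u (X′ , f) → (g : Hom C X Y) →
             IsLift P Y (_∘_ D (F₁ P g) u) (X′ , _∘_ C g f)
  IsLift-∘ {f = f} (refl , refl) g = refl , homomorphism P f g

  lifts-unique : ∀ {X D′} {u : Hom D D′ (F₀ P X)} {ṽ w̃ : Σ[ X′ ∈ Obj C ] Hom C X′ X} →
                 IsLift P X u ṽ → IsLift P X u w̃ → ṽ ≡ w̃
  lifts-unique {X} {u = u} {ṽ} {w̃} v w =
    trans (proj₂ (proj₂ (fib X u)) ṽ v) (sym (proj₂ (proj₂ (fib X u)) w̃ w))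

  faithful : ∀ {A B} (f g : Hom C A B) → F₁ P f ≡ F₁ P g → f ≡ g
  faithful {A} f g eq = ,-injectiveʳ (lifts-unique {ṽ = A , f} (refl , refl) (refl , sym eq))

  private
    lift-at-A : ∀ {A B A′} (g : Hom D (F₀ P A) (F₀ P B)) (f : Hom C A′ B) →
                A′ ≡ A → IsLift P B g (A′ , f) → Σ[ f ∈ Hom C A B ] F₁ P f ≡ g
    lift-at-A g f refl (refl , P₁f≡g) = f , P₁f≡g

  injective₀⇒full : (∀ {A B} → F₀ P A ≡ F₀ P B → A ≡ B) →
                    ∀ {A B} (g : Hom D (F₀ P A) (F₀ P B)) → Σ[ f ∈ Hom C A B ] F₁ P f ≡ g
  injective₀⇒full injective {B = B} g with fib B g
  ... | (A′ , f) , isLift , _ = lift-at-A g f (injective (proj₁ isLift)) isLift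

  module WithLeftAdjoint {L : Functor D C} (adj : Adjunction L P) where
    open Adjunction adj

    liftOfUnit : ∀ X → Σ[ X′ ∈ Obj C ] Hom C X′ (F₀ L X)
    liftOfUnit X = proj₁ (fib (F₀ L X) (η unit X))

    isLift-liftOfUnit : ∀ X → IsLift P (F₀ L X) (η unit X) (liftOfUnit X)
    isLift-liftOfUnit X = proj₁ (proj₂ (fib (F₀ L X) (η unit X)))

    G₀ : Obj D → Obj C
    G₀ X = proj₁ (liftOfUnit X)

    P₀∘G₀ : ∀ X → F₀ P (G₀ X) ≡ X
    P₀∘G₀ X = proj₁ (isLift-liftOfUnit X)

    G₀∘P₀ : ∀ Y → G₀ (F₀ P Y) ≡ Y
    G₀∘P₀ Y = cong proj₁ (lifts-unique counit-lift (refl , identity P))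
      where
      ε∘ũ : Σ[ Y′ ∈ Obj C ] Hom C Y′ Y
      ε∘ũ = G₀ (F₀ P Y) , _∘_ C (η counit Y) (proj₂ (liftOfUnit (F₀ P Y)))

      counit-lift : IsLift P Y (id D) ε∘ũ
      counit-lift = subst (λ u → IsLift P Y u ε∘ũ) (zag Y)
                          (IsLift-∘ (isLift-liftOfUnit (F₀ P Y)) (η counit Y))

    injective₀ : ∀ {A B} → F₀ P A ≡ F₀ P B → A ≡ B
    injective₀ {A} {B} e = trans (sym (G₀∘P₀ A)) (trans (cong G₀ e) (G₀∘P₀ B))

    leftAdjoint⇒IsIsomorphism : IsIsomorphism P
    leftAdjoint⇒IsIsomorphism = bijective₀-fullyFaithful⇒IsIsomorphism P
      G₀ P₀∘G₀ G₀∘P₀ (injective₀⇒full injective₀) faithful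

mainTheorem15 : ∀ {o ℓ o′ ℓ′} {C : Category o ℓ} {D : Category o′ ℓ′}
                (P : Functor C D) → IsDiscreteFibration P →
                (HasLeftAdjoint P ⇔ IsIsomorphism P)
mainTheorem15 P fib = mk⇔
  (λ (_ , adj) → DiscreteFibration.WithLeftAdjoint.leftAdjoint⇒IsIsomorphism fib adj)
  (λ I → IsIsomorphism.inv I , IsIsomorphism⇒inv⊣ I)
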